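{- Let $P$ be a dcpo, $L$ a dcpo-$\vee_{\uparrow}$-semilattice, $f : P \to L$ a Scott continuous function, and $A \subseteq P$. Let $cl(A)$ be the Scott closure of $A$ in $P$. Then: (1) $\bigvee f(A)$ exists in $L$ if and only if $\bigvee f(cl(A))$ exists in $L$, and in that case $\bigvee f(A) = \bigvee f(cl(A))$; (2) $A$ is $\bigvee$-existing if and only if $cl(A)$ is $\bigvee$-existing.
   Context: A subset of a poset is consistent if it has an upper bound. A dcpo-$\vee_{\uparrow}$-semilattice is a dcpo in which every consistent pair of elements has a join. A subset of a dcpo is Scott closed if it is a lower set closed under suprema of directed subsets; $cl(A)$ is the smallest Scott closed set containing $A$. A subset $A$ of a dcpo $P$ is called $\bigvee$-existing if for every Scott continuous function $g : P \to M$ into any dcpo-$\vee_{\uparrow}$-semilattice $M$, the supremum $\bigvee g(A)$ exists in $M$. -}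

module Defs where

open import Level using (Level; suc; _⊔_)
open import Data.Product using (Σ; ∃; _×_; _,_)
open import Data.Sum using (_⊎_)
open import Relation.Unary using (Pred; _⊆_)
open import Relation.Binary.Bundles using (Poset)

module _ {c ℓ₁ ℓ₂ : Level} (P : Poset c ℓ₁ ℓ₂) where
  open Poset P

  UpperBound : {a : Level} → Pred Carrier a → Carrier → Set (a ⊔ c ⊔ ℓ₂)
  UpperBound S u = ∀ {x} → S x → x ≤ u

  IsSup : {a : Level} → Pred Carrier a → Carrier → Set (a ⊔ c ⊔ ℓ₂)
  IsSup S s = UpperBound S s × (∀ u → UpperBound S u → s ≤ u)

  HasSup : {a : Level} → Pred Carrier a → Set (a ⊔ c ⊔ ℓ₂)
  HasSup S = Σ Carrier (IsSup S)

  Directed : {a : Level} → Pred Carrier a → Set (a ⊔ c ⊔ ℓ₂)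
  Directed D = (∃ λ x → D x)
             × (∀ {x y} → D x → D y → ∃ λ z → D z × x ≤ z × y ≤ z)

  Consistent : Carrier → Carrier → Set (c ⊔ ℓ₂)
  Consistent x y = ∃ λ u → x ≤ u × y ≤ u

  Pair : Carrier → Carrier → Pred Carrier ℓ₁
  Pair x y z = z ≈ x ⊎ z ≈ y

record DCPO (ℓ : Level) : Set (suc ℓ) where
  field
    poset : Poset ℓ ℓ ℓ
  open Poset poset public
  field
    dsup : (D : Pred Carrier ℓ) → Directed poset D → HasSup poset D

record DcpoJoinSemilattice (ℓ : Level) : Set (suc ℓ) where
  field
    dcpo : DCPO ℓ
  open DCPO dcpo public
  field
    join : ∀ x y → Consistent poset x y → HasSup poset (Pair poset x y)

open DCPO

Image : {ℓ a : Level} (P Q : DCPO ℓ) → (Carrier P → Carrier Q)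
      → Pred (Carrier P) a → Pred (Carrier Q) (ℓ ⊔ a)
Image P Q f S y = ∃ λ x → S x × _≈_ Q (f x) y

ScottContinuous : {ℓ : Level} (P Q : DCPO ℓ) → (Carrier P → Carrier Q) → Set (suc ℓ)
ScottContinuous P Q f =
  (D : Pred (Carrier P) _) → Directed (poset P) D →
  ∀ s → IsSup (poset P) D s → IsSup (poset Q) (Image P Q f D) (f s)

ScottClosed : {ℓ : Level} (P : DCPO ℓ) → Pred (Carrier P) ℓ → Set (suc ℓ)
ScottClosed P C =
  (∀ {x y} → _≤_ P x y → C y → C x) ×
  ((D : Pred (Carrier P) _) → Directed (poset P) D → D ⊆ C →
     ∀ s → IsSup (poset P) D s → C s)

cl : {ℓ : Level} (P : DCPO ℓ) → Pred (Carrier P) ℓ → Pred (Carrier P) (suc ℓ)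
cl P A x = (C : Pred (Carrier P) _) → ScottClosed P C → A ⊆ C → C x

⋁-existing : {ℓ a : Level} (P : DCPO ℓ) → Pred (Carrier P) a → Set (suc ℓ ⊔ a)
⋁-existing {ℓ} P A =
  (M : DcpoJoinSemilattice ℓ) (g : Carrier P → DcpoJoinSemilattice.Carrier M) →
  ScottContinuous P (DcpoJoinSemilattice.dcpo M) g →
  HasSup (DcpoJoinSemilattice.poset M) (Image P (DcpoJoinSemilattice.dcpo M) g A)

module Submission where

open import Defs
open import Level using (Level)
open import Data.Product using (_×_; _,_; proj₁; proj₂)
open import Data.Sum using (inj₁; inj₂)
open import Relation.Binary.Bundles using (Poset)
open import Relation.Unary using (Pred; _⊆_)

-- For every u, the set {x | f x ≤ u} is Scott closed, so it contains cl(A) as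
-- soon as it contains A.  Hence f(A) and f(cl A) have the same upper bounds, and
-- therefore the same suprema.

module _ {c ℓ₁ ℓ₂ : Level} (Q : Poset c ℓ₁ ℓ₂) where
  open Poset Q

  IsSup-unique : {a : Level} {S : Pred Carrier a} {s t : Carrier} →
                 IsSup Q S s → IsSup Q S t → s ≈ t
  IsSup-unique (ub-s , least-s) (ub-t , least-t) =
    antisym (least-s _ ub-t) (least-t _ ub-s)

  IsSup-transport : {a b : Level} {S : Pred Carrier a} {T : Pred Carrier b} →
                    (∀ u → UpperBound Q S u → UpperBound Q T u) →
                    (∀ u → UpperBound Q T u → UpperBound Q S u) →
                    ∀ {s} → IsSup Q S s → IsSup Q T s
  IsSup-transport S⇒T T⇒S (ub , least) = S⇒T _ ub , λ u ub-T → least u (T⇒S u ub-T)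

  HasSup-transport : {a b : Level} {S : Pred Carrier a} {T : Pred Carrier b} →
                     (∀ u → UpperBound Q S u → UpperBound Q T u) →
                     (∀ u → UpperBound Q T u → UpperBound Q S u) →
                     HasSup Q S → HasSup Q T
  HasSup-transport S⇒T T⇒S (s , sup) = s , IsSup-transport S⇒T T⇒S sup

⊆-cl : {ℓ : Level} (P : DCPO ℓ) (A : Pred (DCPO.Carrier P) ℓ) → A ⊆ cl P A
⊆-cl P A x∈A C _ A⊆C = A⊆C x∈A

module _ {ℓ : Level} (P Q : DCPO ℓ) (f : DCPO.Carrier P → DCPO.Carrier Q) where
  private
    module P = DCPO P
    module Q = DCPO Q

  UpperBound-Image-⊆ : {a b : Level} {A : Pred P.Carrier a} {B : Pred P.Carrier b} →
                       A ⊆ B → ∀ u → UpperBound Q.poset (Image P Q f B) u →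
                       UpperBound Q.poset (Image P Q f A) u
  UpperBound-Image-⊆ A⊆B u ub (x , x∈A , fx≈y) = ub (x , A⊆B x∈A , fx≈y)

  module _ (f-continuous : ScottContinuous P Q f) where

    ScottContinuous⇒monotone : ∀ {x y} → x P.≤ y → f x Q.≤ f y
    ScottContinuous⇒monotone {x} {y} x≤y =
      proj₁ (f-continuous D D-directed y y-sup) (x , inj₁ P.Eq.refl , Q.Eq.refl)
      where
      D : Pred P.Carrier ℓ
      D = Pair P.poset x y
      below-y : UpperBound P.poset D y
      below-y (inj₁ z≈x) = P.trans (P.reflexive z≈x) x≤y
      below-y (inj₂ z≈y) = P.reflexive z≈y
      D-directed : Directed P.poset D
      D-directed = (x , inj₁ P.Eq.refl) ,
                   λ z∈D w∈D → y , inj₂ P.Eq.refl , below-y z∈D , below-y w∈D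
      y-sup : IsSup P.poset D y
      y-sup = below-y , λ u ub → ub (inj₂ P.Eq.refl)

    preimage-↓-ScottClosed : ∀ u → ScottClosed P (λ x → f x Q.≤ u)
    preimage-↓-ScottClosed u =
      (λ x≤y fy≤u → Q.trans (ScottContinuous⇒monotone x≤y) fy≤u) ,
      λ D D-directed fD≤u s s-sup →
        proj₂ (f-continuous D D-directed s s-sup) u
          λ { (x , x∈D , fx≈y) → Q.trans (Q.reflexive (Q.Eq.sym fx≈y)) (fD≤u x∈D) }

    UpperBound-Image-cl : (A : Pred P.Carrier ℓ) → ∀ u →
                          UpperBound Q.poset (Image P Q f A) u →
                          UpperBound Q.poset (Image P Q f (cl P A)) u
    UpperBound-Image-cl A u ub (x , x∈clA , fx≈y) =
      Q.trans (Q.reflexive (Q.Eq.sym fx≈y))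
              (x∈clA _ (preimage-↓-ScottClosed u) λ z∈A → ub (_ , z∈A , Q.Eq.refl))

    HasSup-Image-cl : (A : Pred P.Carrier ℓ) →
                      HasSup Q.poset (Image P Q f A) → HasSup Q.poset (Image P Q f (cl P A))
    HasSup-Image-cl A =
      HasSup-transport Q.poset (UpperBound-Image-cl A) (UpperBound-Image-⊆ (⊆-cl P A))

    HasSup-Image-cl⁻ : (A : Pred P.Carrier ℓ) →
                       HasSup Q.poset (Image P Q f (cl P A)) → HasSup Q.poset (Image P Q f A)
    HasSup-Image-cl⁻ A =
      HasSup-transport Q.poset (UpperBound-Image-⊆ (⊆-cl P A)) (UpperBound-Image-cl A)

    IsSup-Image-cl : (A : Pred P.Carrier ℓ) → ∀ {s} →
                     IsSup Q.poset (Image P Q f A) s → IsSup Q.poset (Image P Q f (cl P A)) s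
    IsSup-Image-cl A =
      IsSup-transport Q.poset (UpperBound-Image-cl A) (UpperBound-Image-⊆ (⊆-cl P A))

proposition3p2 : {ℓ : Level} (P : DCPO ℓ) (L : DcpoJoinSemilattice ℓ)
    (f : DCPO.Carrier P → DcpoJoinSemilattice.Carrier L) →
    ScottContinuous P (DcpoJoinSemilattice.dcpo L) f →
    (A : Pred (DCPO.Carrier P) ℓ) →
    ((HasSup (DcpoJoinSemilattice.poset L) (Image P (DcpoJoinSemilattice.dcpo L) f A) →
      HasSup (DcpoJoinSemilattice.poset L) (Image P (DcpoJoinSemilattice.dcpo L) f (cl P A)))
     × (HasSup (DcpoJoinSemilattice.poset L) (Image P (DcpoJoinSemilattice.dcpo L) f (cl P A)) →
      HasSup (DcpoJoinSemilattice.poset L) (Image P (DcpoJoinSemilattice.dcpo L) f A))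
     × (∀ s t → IsSup (DcpoJoinSemilattice.poset L) (Image P (DcpoJoinSemilattice.dcpo L) f A) s →
      IsSup (DcpoJoinSemilattice.poset L) (Image P (DcpoJoinSemilattice.dcpo L) f (cl P A)) t →
      DcpoJoinSemilattice._≈_ L s t))
    × ((⋁-existing P A → ⋁-existing P (cl P A)) × (⋁-existing P (cl P A) → ⋁-existing P A))
proposition3p2 P L f f-continuous A =
  ( HasSup-Image-cl P L.dcpo f f-continuous A
  , HasSup-Image-cl⁻ P L.dcpo f f-continuous A
  , λ s t s-sup t-sup →
      IsSup-unique L.poset (IsSup-Image-cl P L.dcpo f f-continuous A s-sup) t-sup )
  , (λ A-existing M g g-continuous →
       HasSup-Image-cl P (DcpoJoinSemilattice.dcpo M) g g-continuous A (A-existing M g g-continuous))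
  , (λ clA-existing M g g-continuous →
       HasSup-Image-cl⁻ P (DcpoJoinSemilattice.dcpo M) g g-continuous A (clA-existing M g g-continuous))
  where
  module L = DcpoJoinSemilattice L
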